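{- Let $X$ and $Y$ be edge-disjoint matchings and let $\ell_{Y}$ be a fixed ordering of $Y$. Then there is an ordering $\ell_{X}$ of $X$ such that $\mathrm{ms}( \ell_{X} \vee \ell_{Y}) \geq \frac{1}{2}|E(X)|$.
   Context: All graphs are simple; a matching is a 1-regular graph; two edges are adjacent if they share a vertex. An ordering of a graph $G$ with $m$ edges is a bijection $\ell:E(G)\to\mathbb{Z}_m$; for distinct edges $e,e'$, $d_\ell(e,e')$ is the smallest positive integer $d$ with $\ell(e)+d=\ell(e')$ in $\mathbb{Z}_m$. $\mathrm{ms}(\ell)$ is the largest $s\in\{1,\dots,m\}$ such that $d_\ell(e,e')\geq s$ for every ordered pair $(e,e')$ of adjacent edges with $\ell(e)<\ell(e')$. For edge-disjoint graphs $G_0,G_1$ with orderings $\ell_0,\ell_1$, $\ell_0\vee\ell_1$ is the ordering $\ell$ of $G_0\cup G_1$ with $\ell(e)=\ell_0(e)$ for $e\in E(G_0)$ and $\ell(e)=|E(G_0)|+\ell_1(e)$ for $e\in E(G_1)$. -}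

module Defs where

open import Data.Nat using (ℕ; _≤_; _<_; _∸_)
open import Data.Product using (_×_; ∃; _,_)
open import Data.Sum using (_⊎_)
open import Data.Fin using (Fin; toℕ)
open import Data.List using (List; length; lookup)
open import Data.List.Relation.Unary.All using (All)
open import Data.List.Relation.Unary.AllPairs using (AllPairs)
open import Data.List.Membership.Propositional using (_∈_; _∉_)
open import Relation.Binary.PropositionalEquality using (_≡_; _≢_)
open import Relation.Nullary using (¬_)

-- Vertices are natural numbers; an edge {u,v} is stored canonically as (u , v) with u < v
-- (so there are no loops and each unordered pair has one representation).
Vertex : Set
Vertex = ℕ

Edge : Set
Edge = Vertex × Vertex

WellFormed : Edge → Set
WellFormed (u , v) = u < v

Incident : Vertex → Edge → Set
Incident x (u , v) = x ≡ u ⊎ x ≡ v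

ShareVertex : Edge → Edge → Set
ShareVertex e f = ∃ λ x → Incident x e × Incident x f

Adjacent : Edge → Edge → Set
Adjacent e f = e ≢ f × ShareVertex e f

IsMatching : List Edge → Set
IsMatching xs = All WellFormed xs × AllPairs (λ e f → ¬ ShareVertex e f) xs

EdgeDisjoint : List Edge → List Edge → Set
EdgeDisjoint xs ys = ∀ e → e ∈ xs → e ∉ ys

-- An ordering ℓ of a graph with edge list E (duplicate-free) is represented by a list L
-- enumerating E exactly once (L ↭ E); ℓ(e) is the position of e in L.
-- Then ℓ_0 ∨ ℓ_1 is the concatenation L0 ++ L1.

-- d_ℓ(e,e') for ℓ(e) = i < j = ℓ(e') is j - i (the smallest positive d with i + d ≡ j mod m).
dist : ℕ → ℕ → ℕ
dist i j = j ∸ i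

MinSep : List Edge → ℕ → Set
MinSep L s = ∀ (i j : Fin (length L)) → toℕ i < toℕ j →
             Adjacent (lookup L i) (lookup L j) → s ≤ dist (toℕ i) (toℕ j)

IsMs : List Edge → ℕ → Set
IsMs L s = 1 ≤ s × s ≤ length L × MinSep L s ×
           (∀ t → 1 ≤ t → t ≤ length L → MinSep L t → t ≤ s)

module Submission where

-- Order X greedily along ℓ_Y: first the edges of X meeting the first edge of Y,
-- then those of the rest meeting the second edge of Y, and so on, ending with the
-- edges of X that meet no edge of Y.  As X is a matching, an edge of Y meets at
-- most two edges of X, so an edge of X meeting the j-th edge of Y (counting from 0)
-- lands at a position i ≤ 2j + 1 < |X|, hence at distance |X| + j − i ≥ ⌈|X|/2⌉
-- from it in ℓ_X ∨ ℓ_Y.  Adjacent pairs inside X or inside Y do not exist.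

open import Defs
open import Data.Nat using (ℕ; _≤_; _*_)
open import Data.Product using (_×_; ∃-syntax)
open import Data.List using (List; length; _++_)
open import Data.List.Relation.Binary.Permutation.Propositional using (_↭_)

open import Data.Nat using (zero; suc; _+_; _<_; _∸_; z≤n; s≤s; _≟_; _≤?_; ⌊_/2⌋; ⌈_/2⌉)
open import Data.Nat.Properties
open import Data.Fin using (Fin; toℕ)
open import Data.Fin.Properties using (toℕ<n)
open import Data.List using ([]; _∷_; lookup; filter)
open import Data.List.Properties using (length-++-≤ˡ; partition-defn)
open import Data.List.Membership.Propositional.Properties using (∈-lookup; ∈-filter⁻)
open import Data.List.Relation.Unary.All as All using (All; []; _∷_)
open import Data.List.Relation.Unary.All.Properties using (all-filter)
open import Data.List.Relation.Unary.AllPairs using (AllPairs; []; _∷_)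
import Data.List.Relation.Unary.AllPairs.Properties as AllPairs
open import Data.List.Relation.Binary.Permutation.Propositional
  using (↭-refl; ↭-trans; ↭-sym; ↭⇒↭ₛ; ↭ₛ⇒↭)
open import Data.List.Relation.Binary.Permutation.Propositional.Properties
  using (++⁺ˡ; ∈-resp-↭; ↭-length)
import Data.List.Relation.Binary.Permutation.Setoid.Properties as PermutationSetoid
open import Data.Product using (_,_; ∃; proj₂)
open import Data.Sum using (_⊎_; inj₁; inj₂)
open import Data.Empty using (⊥; ⊥-elim)
open import Function using (_∘_)
open import Relation.Binary.Definitions using (Symmetric; _Respects_)
open import Relation.Nullary using (¬_; Dec; yes; no; map′)
open import Relation.Nullary.Decidable using (_⊎-dec_)
open import Relation.Unary using (Decidable)
open import Relation.Unary.Properties using (∁?)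
open import Relation.Binary.PropositionalEquality
  using (_≡_; refl; sym; cong; subst; subst₂; setoid; resp₂)

module _ {a} {A : Set a} where

  AllPairs-resp-↭ : ∀ {r} {R : A → A → Set r} → Symmetric R → (AllPairs R) Respects _↭_
  AllPairs-resp-↭ {R = R} R-sym =
    PermutationSetoid.AllPairs-resp-↭ (setoid A) R-sym (resp₂ R) ∘ ↭⇒↭ₛ

  filter-∁-↭ : ∀ {p} {P : A → Set p} (P? : Decidable P) xs →
    xs ↭ filter P? xs ++ filter (∁? P?) xs
  filter-∁-↭ P? xs = subst (λ (ys , zs) → xs ↭ ys ++ zs) (partition-defn P? xs)
    (↭ₛ⇒↭ (PermutationSetoid.partition-↭ (setoid A) P? xs))

  AllPairs-lookup : ∀ {r} {R : A → A → Set r} {xs} → AllPairs R xs →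
    (i j : Fin (length xs)) → toℕ i < toℕ j → R (lookup xs i) (lookup xs j)
  AllPairs-lookup (r ∷ _) Fin.zero (Fin.suc j) _ = All.lookup r (∈-lookup j)
  AllPairs-lookup (_ ∷ rs) (Fin.suc i) (Fin.suc j) (s≤s i<j) = AllPairs-lookup rs i j i<j

  lookup-++-split : (xs ys : List A) (i : Fin (length (xs ++ ys))) →
    (∃ λ (i′ : Fin (length xs)) → toℕ i ≡ toℕ i′ × lookup (xs ++ ys) i ≡ lookup xs i′) ⊎
    (∃ λ (j : Fin (length ys)) → toℕ i ≡ length xs + toℕ j × lookup (xs ++ ys) i ≡ lookup ys j)
  lookup-++-split [] ys i = inj₂ (i , refl , refl)
  lookup-++-split (x ∷ xs) ys Fin.zero = inj₁ (Fin.zero , refl , refl)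
  lookup-++-split (x ∷ xs) ys (Fin.suc i) with lookup-++-split xs ys i
  ... | inj₁ (i′ , i≡i′ , eq) = inj₁ (Fin.suc i′ , cong suc i≡i′ , eq)
  ... | inj₂ (j , i≡xs+j , eq) = inj₂ (j , cong suc i≡xs+j , eq)

VertexDisjoint : Edge → Edge → Set
VertexDisjoint e f = ¬ ShareVertex e f

ShareVertex-sym : ∀ {e f} → ShareVertex e f → ShareVertex f e
ShareVertex-sym (v , v∈e , v∈f) = v , v∈f , v∈e

VertexDisjoint-sym : ∀ {e f} → VertexDisjoint e f → VertexDisjoint f e
VertexDisjoint-sym e#f = e#f ∘ ShareVertex-sym

shareVertex? : (e f : Edge) → Dec (ShareVertex e f)
shareVertex? (u , v) f@(a , b) =
  map′ meet endpoint ((u ≟ a ⊎-dec u ≟ b) ⊎-dec (v ≟ a ⊎-dec v ≟ b))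
  where
  meet : Incident u f ⊎ Incident v f → ShareVertex (u , v) f
  meet (inj₁ u∈f) = u , inj₁ refl , u∈f
  meet (inj₂ v∈f) = v , inj₂ refl , v∈f
  endpoint : ShareVertex (u , v) f → Incident u f ⊎ Incident v f
  endpoint (_ , inj₁ refl , u∈f) = inj₁ u∈f
  endpoint (_ , inj₂ refl , v∈f) = inj₂ v∈f

-- Pigeonhole on the two endpoints of f.
¬three-disjoint-meet : ∀ {e₁ e₂ e₃} f →
  VertexDisjoint e₁ e₂ → VertexDisjoint e₁ e₃ → VertexDisjoint e₂ e₃ →
  ShareVertex e₁ f → ShareVertex e₂ f → ShareVertex e₃ f → ⊥
¬three-disjoint-meet (a , b) d₁₂ d₁₃ d₂₃ (_ , i₁ , inj₁ refl) (_ , i₂ , inj₁ refl) _ = d₁₂ (a , i₁ , i₂)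
¬three-disjoint-meet (a , b) d₁₂ d₁₃ d₂₃ (_ , i₁ , inj₂ refl) (_ , i₂ , inj₂ refl) _ = d₁₂ (b , i₁ , i₂)
¬three-disjoint-meet (a , b) d₁₂ d₁₃ d₂₃ (_ , i₁ , inj₁ refl) _ (_ , i₃ , inj₁ refl) = d₁₃ (a , i₁ , i₃)
¬three-disjoint-meet (a , b) d₁₂ d₁₃ d₂₃ (_ , i₁ , inj₂ refl) _ (_ , i₃ , inj₂ refl) = d₁₃ (b , i₁ , i₃)
¬three-disjoint-meet (a , b) d₁₂ d₁₃ d₂₃ _ (_ , i₂ , inj₁ refl) (_ , i₃ , inj₁ refl) = d₂₃ (a , i₂ , i₃)
¬three-disjoint-meet (a , b) d₁₂ d₁₃ d₂₃ _ (_ , i₂ , inj₂ refl) (_ , i₃ , inj₂ refl) = d₂₃ (b , i₂ , i₃)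

disjoint-meeting-length≤2 : ∀ f {xs} → AllPairs VertexDisjoint xs →
  All (λ e → ShareVertex e f) xs → length xs ≤ 2
disjoint-meeting-length≤2 f [] [] = z≤n
disjoint-meeting-length≤2 f (_ ∷ []) (_ ∷ []) = s≤s z≤n
disjoint-meeting-length≤2 f (_ ∷ _ ∷ []) (_ ∷ _ ∷ []) = ≤-refl
disjoint-meeting-length≤2 f ((d₁₂ ∷ d₁₃ ∷ _) ∷ (d₂₃ ∷ _) ∷ _) (m₁ ∷ m₂ ∷ m₃ ∷ _) =
  ⊥-elim (¬three-disjoint-meet f d₁₂ d₁₃ d₂₃ m₁ m₂ m₃)

meets? : ∀ f e → Dec (ShareVertex e f)
meets? f e = shareVertex? e f

filter-meets-length≤2 : ∀ f xs → AllPairs VertexDisjoint xs → length (filter (meets? f) xs) ≤ 2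
filter-meets-length≤2 f xs disjoint =
  disjoint-meeting-length≤2 f (AllPairs.filter⁺ (meets? f) disjoint) (all-filter (meets? f) xs)

orderAlong : List Edge → List Edge → List Edge
orderAlong [] xs = xs
orderAlong (f ∷ ys) xs = filter (meets? f) xs ++ orderAlong ys (filter (∁? (meets? f)) xs)

orderAlong-↭ : ∀ ys xs → orderAlong ys xs ↭ xs
orderAlong-↭ [] xs = ↭-refl
orderAlong-↭ (f ∷ ys) xs =
  ↭-trans (++⁺ˡ (filter (meets? f) xs) (orderAlong-↭ ys _)) (↭-sym (filter-∁-↭ (meets? f) xs))

orderAlong-position : ∀ ys xs → AllPairs VertexDisjoint xs →
  (i : Fin (length (orderAlong ys xs))) (j : Fin (length ys)) →
  ShareVertex (lookup (orderAlong ys xs) i) (lookup ys j) → toℕ i < 2 * suc (toℕ j)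
orderAlong-position (f ∷ ys) xs disjoint i j meet
  with lookup-++-split (filter (meets? f) xs) (orderAlong ys (filter (∁? (meets? f)) xs)) i
... | inj₁ (i′ , i≡ , _) = begin-strict
  toℕ i                           ≡⟨ i≡ ⟩
  toℕ i′                          <⟨ toℕ<n i′ ⟩
  length (filter (meets? f) xs)   ≤⟨ filter-meets-length≤2 f xs disjoint ⟩
  2                               ≤⟨ *-monoʳ-≤ 2 (s≤s z≤n) ⟩
  2 * suc (toℕ j)                 ∎
  where open ≤-Reasoning
... | inj₂ (i′ , i≡ , eq) with j
...   | Fin.zero = ⊥-elim (avoids-f (subst (λ e → ShareVertex e f) eq meet))
  where
  avoids-f = proj₂ (∈-filter⁻ (∁? (meets? f)) {xs = xs} (∈-resp-↭ (orderAlong-↭ ys _) (∈-lookup i′)))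
...   | Fin.suc j′ = begin-strict
  toℕ i                                             ≡⟨ i≡ ⟩
  length (filter (meets? f) xs) + toℕ i′            <⟨ +-mono-≤-< (filter-meets-length≤2 f xs disjoint) rest-bound ⟩
  2 + 2 * suc (toℕ j′)                              ≡⟨ sym (*-suc 2 (suc (toℕ j′))) ⟩
  2 * suc (toℕ (Fin.suc j′))                        ∎
  where
  open ≤-Reasoning
  rest-bound = orderAlong-position ys _ (AllPairs.filter⁺ (∁? (meets? f)) disjoint) i′ j′
                 (subst (λ e → ShareVertex e (lookup ys j′)) eq meet)

MinSep-++ : ∀ {xs ys s} → AllPairs VertexDisjoint xs → AllPairs VertexDisjoint ys →
  (∀ i j → ShareVertex (lookup xs i) (lookup ys j) → s ≤ dist (toℕ i) (length xs + toℕ j)) →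
  MinSep (xs ++ ys) s
MinSep-++ {xs} {ys} {s} disjoint-xs disjoint-ys cross i j i<j (_ , meet)
  with lookup-++-split xs ys i | lookup-++-split xs ys j
... | inj₁ (i′ , i≡ , eqᵢ) | inj₁ (j′ , j≡ , eqⱼ) =
  ⊥-elim (AllPairs-lookup disjoint-xs i′ j′ (subst₂ _<_ i≡ j≡ i<j) (subst₂ ShareVertex eqᵢ eqⱼ meet))
... | inj₂ (i′ , i≡ , eqᵢ) | inj₂ (j′ , j≡ , eqⱼ) =
  ⊥-elim (AllPairs-lookup disjoint-ys i′ j′ (+-cancelˡ-< (length xs) _ _ (subst₂ _<_ i≡ j≡ i<j))
           (subst₂ ShareVertex eqᵢ eqⱼ meet))
... | inj₂ (i′ , i≡ , _) | inj₁ (j′ , j≡ , _) = ⊥-elim (<⇒≱ i<j j≤i)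
  where
  open ≤-Reasoning
  j≤i : toℕ j ≤ toℕ i
  j≤i = begin
    toℕ j               ≡⟨ j≡ ⟩
    toℕ j′              ≤⟨ <⇒≤ (toℕ<n j′) ⟩
    length xs           ≤⟨ m≤m+n (length xs) (toℕ i′) ⟩
    length xs + toℕ i′  ≡⟨ sym i≡ ⟩
    toℕ i               ∎
... | inj₁ (i′ , i≡ , eqᵢ) | inj₂ (j′ , j≡ , eqⱼ) =
  subst₂ (λ a b → s ≤ dist a b) (sym i≡) (sym j≡) (cross i′ j′ (subst₂ ShareVertex eqᵢ eqⱼ meet))

⌈n/2⌉≤1+⌊n/2⌋ : ∀ n → ⌈ n /2⌉ ≤ suc ⌊ n /2⌋
⌈n/2⌉≤1+⌊n/2⌋ zero = z≤n
⌈n/2⌉≤1+⌊n/2⌋ (suc zero) = s≤s z≤n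
⌈n/2⌉≤1+⌊n/2⌋ (suc (suc n)) = s≤s (⌈n/2⌉≤1+⌊n/2⌋ n)

n≤2*⌈n/2⌉ : ∀ n → n ≤ 2 * ⌈ n /2⌉
n≤2*⌈n/2⌉ n = begin
  n                          ≡⟨ sym (⌊n/2⌋+⌈n/2⌉≡n n) ⟩
  ⌊ n /2⌋ + ⌈ n /2⌉          ≤⟨ +-monoˡ-≤ ⌈ n /2⌉ (⌊n/2⌋≤⌈n/2⌉ n) ⟩
  ⌈ n /2⌉ + ⌈ n /2⌉          ≡⟨ cong (⌈ n /2⌉ +_) (sym (+-identityʳ ⌈ n /2⌉)) ⟩
  2 * ⌈ n /2⌉                ∎
  where open ≤-Reasoning

⌈n/2⌉≤n+j∸i : ∀ {n i j} → i < n → i < 2 * suc j → ⌈ n /2⌉ ≤ n + j ∸ i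
⌈n/2⌉≤n+j∸i {n} {i} {j} i<n i<2[1+j] = m+n≤o⇒m≤o∸n ⌈ n /2⌉ (bound (⌊ n /2⌋ ≤? j))
  where
  open ≤-Reasoning
  bound : Dec (⌊ n /2⌋ ≤ j) → ⌈ n /2⌉ + i ≤ n + j
  bound (yes ⌊n/2⌋≤j) = begin
    ⌈ n /2⌉ + i        ≤⟨ +-monoˡ-≤ i (⌈n/2⌉≤1+⌊n/2⌋ n) ⟩
    suc ⌊ n /2⌋ + i    ≡⟨ sym (+-suc ⌊ n /2⌋ i) ⟩
    ⌊ n /2⌋ + suc i    ≤⟨ +-mono-≤ ⌊n/2⌋≤j i<n ⟩
    j + n              ≡⟨ +-comm j n ⟩
    n + j              ∎
  bound (no ⌊n/2⌋≰j) = begin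
    ⌈ n /2⌉ + i                    ≤⟨ +-monoʳ-≤ ⌈ n /2⌉ (≤-pred i<2[1+j]) ⟩
    ⌈ n /2⌉ + (j + (suc j + 0))    ≡⟨ cong (λ k → ⌈ n /2⌉ + (j + k)) (+-identityʳ (suc j)) ⟩
    ⌈ n /2⌉ + (j + suc j)          ≤⟨ +-monoʳ-≤ ⌈ n /2⌉ (+-monoʳ-≤ j (≰⇒> ⌊n/2⌋≰j)) ⟩
    ⌈ n /2⌉ + (j + ⌊ n /2⌋)        ≡⟨ +-comm ⌈ n /2⌉ (j + ⌊ n /2⌋) ⟩
    (j + ⌊ n /2⌋) + ⌈ n /2⌉        ≡⟨ +-assoc j ⌊ n /2⌋ ⌈ n /2⌉ ⟩
    j + (⌊ n /2⌋ + ⌈ n /2⌉)        ≡⟨ cong (j +_) (⌊n/2⌋+⌈n/2⌉≡n n) ⟩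
    j + n                          ≡⟨ +-comm j n ⟩
    n + j                          ∎

MinSep⇒≤ms : ∀ L {s t} → IsMs L s → MinSep L t → t ≤ length L → t ≤ s
MinSep⇒≤ms L {t = zero} _ _ _ = z≤n
MinSep⇒≤ms L {t = suc t} (_ , _ , _ , maximal) separated t≤L = maximal (suc t) (s≤s z≤n) t≤L separated

lemma2p5 : (X Y : List Edge) → IsMatching X → IsMatching Y → EdgeDisjoint X Y →
    ∃[ LX ] (LX ↭ X × (∀ s → IsMs (LX ++ Y) s → length X ≤ 2 * s))
lemma2p5 X Y (_ , disjoint-X) (_ , disjoint-Y) _ = LX , orderAlong-↭ Y X , X≤2*ms
  where
  LX = orderAlong Y X
  n = length LX
  separated : MinSep (LX ++ Y) ⌈ n /2⌉
  separated =
    MinSep-++ (AllPairs-resp-↭ VertexDisjoint-sym (↭-sym (orderAlong-↭ Y X)) disjoint-X) disjoint-Y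
      λ i j meet → ⌈n/2⌉≤n+j∸i (toℕ<n i) (orderAlong-position Y X disjoint-X i j meet)
  X≤2*ms : ∀ s → IsMs (LX ++ Y) s → length X ≤ 2 * s
  X≤2*ms s ms = begin
    length X        ≡⟨ sym (↭-length (orderAlong-↭ Y X)) ⟩
    n               ≤⟨ n≤2*⌈n/2⌉ n ⟩
    2 * ⌈ n /2⌉     ≤⟨ *-monoʳ-≤ 2 (MinSep⇒≤ms (LX ++ Y) ms separated ⌈n/2⌉≤length) ⟩
    2 * s           ∎
    where
    open ≤-Reasoning
    ⌈n/2⌉≤length : ⌈ n /2⌉ ≤ length (LX ++ Y)
    ⌈n/2⌉≤length = ≤-trans (⌈n/2⌉≤n n) (length-++-≤ˡ LX)
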